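{- Let $\Gamma$ be a maximal $\mathbb{SKHM}$-consistent set and let $\Phi_\Gamma$ be the set of all maximal $\mathbb{SKHM}$-consistent sets $\Delta$ containing exactly the same formulas of the form $\mathcal{K}hm(\psi,\chi,\phi)$ as $\Gamma$. If $\mathcal{K}hm(\psi,\top,\phi)\in\Gamma$, $\Delta\in\Phi_\Gamma$ and $\psi\in\Delta$, then there exists $\Delta'\in\Phi_\Gamma$ with $\phi\in\Delta'$.
   Context: Formulas over a countable set $\mathbf{P}$ of proposition letters: $\phi::=p\mid\neg\phi\mid(\phi\wedge\phi)\mid \mathcal{K}hm(\phi,\phi,\phi)$; $\top,\bot,\vee,\to$ usual abbreviations; $\mathcal{U}\phi$ abbreviates $\mathcal{K}hm(\neg\phi,\top,\bot)$. The system $\mathbb{SKHM}$ (with $p,q,r,o,p',q',o'$ proposition letters) has axioms: TAUT all propositional tautologies; DISTU $\mathcal{U}p\wedge\mathcal{U}(p\to q)\to\mathcal{U}q$; TU $\mathcal{U}p\to p$; 4KhmU $\mathcal{K}hm(p,o,q)\to\mathcal{U}\mathcal{K}hm(p,o,q)$; 5KhmU $\neg\mathcal{K}hm(p,o,q)\to\mathcal{U}\neg\mathcal{K}hm(p,o,q)$; EMPKhm $\mathcal{U}(p\to q)\to\mathcal{K}hm(p,\bot,q)$; COMPKhm $\mathcal{K}hm(p,o,r)\wedge\mathcal{K}hm(r,o,q)\wedge\mathcal{U}(r\to o)\to\mathcal{K}hm(p,o,q)$; ONEKhm $\mathcal{K}hm(p,o,q)\wedge\neg\mathcal{K}hm(p,\bot,q)\to\mathcal{K}hm(p,\bot,o)$;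 UKhm $\mathcal{U}(p'\to p)\wedge\mathcal{U}(o\to o')\wedge\mathcal{U}(q\to q')\wedge\mathcal{K}hm(p,o,q)\to\mathcal{K}hm(p',o',q')$; rules MP, NECU (from $\varphi$ infer $\mathcal{U}\varphi$), SUB (uniform substitution). -}

module Defs where

open import Data.Nat using (ℕ)
open import Data.Bool using (Bool; true; false; not; _∧_)
open import Data.List using (List; []; _∷_)
open import Data.List.Relation.Unary.All using (All)
open import Data.Product using (Σ; _×_; _,_)
open import Relation.Binary.PropositionalEquality using (_≡_)
open import Relation.Nullary using (¬_)
open import Function.Bundles using (_⇔_)
open import Level using (Level; _⊔_; suc; zero)

data Form : Set where
  atom : ℕ → Form
  ~_   : Form → Form
  _∧'_ : Form → Form → Form
  Khm  : Form → Form → Form → Form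

infix  30 ~_
infixl 25 _∧'_
infixl 24 _∨'_
infixr 23 _⇒_

⊥' : Form
⊥' = atom 0 ∧' ~ atom 0

⊤' : Form
⊤' = ~ ⊥'

_∨'_ : Form → Form → Form
a ∨' b = ~ (~ a ∧' ~ b)

_⇒_ : Form → Form → Form
a ⇒ b = ~ (a ∧' ~ b)

U : Form → Form
U φ = Khm (~ φ) ⊤' ⊥'

subst : (ℕ → Form) → Form → Form
subst σ (atom n) = σ n
subst σ (~ a) = ~ subst σ a
subst σ (a ∧' b) = subst σ a ∧' subst σ b
subst σ (Khm a b c) = Khm (subst σ a) (subst σ b) (subst σ c)

-- propositional tautologies: true under every Boolean valuation that treats
-- letters and Khm-formulas as propositional atoms
eval : (Form → Bool) → Form → Bool
eval v (atom n) = v (atom n)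
eval v (~ a) = not (eval v a)
eval v (a ∧' b) = eval v a ∧ eval v b
eval v (Khm a b c) = v (Khm a b c)

Taut : Form → Set
Taut φ = ∀ (v : Form → Bool) → eval v φ ≡ true

p q r o p′ q′ o′ : Form
p = atom 0
q = atom 1
r = atom 2
o = atom 3
p′ = atom 4
q′ = atom 5
o′ = atom 6

data ⊢_ : Form → Set where
  TAUT    : ∀ {φ} → Taut φ → ⊢ φ
  DISTU   : ⊢ (U p ∧' U (p ⇒ q) ⇒ U q)
  TU      : ⊢ (U p ⇒ p)
  4KhmU   : ⊢ (Khm p o q ⇒ U (Khm p o q))
  5KhmU   : ⊢ (~ Khm p o q ⇒ U (~ Khm p o q))
  EMPKhm  : ⊢ (U (p ⇒ q) ⇒ Khm p ⊥' q)
  COMPKhm : ⊢ (Khm p o r ∧' Khm r o q ∧' U (r ⇒ o) ⇒ Khm p o q)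
  ONEKhm  : ⊢ (Khm p o q ∧' ~ Khm p ⊥' q ⇒ Khm p ⊥' o)
  UKhm    : ⊢ (U (p′ ⇒ p) ∧' U (o ⇒ o′) ∧' U (q ⇒ q′) ∧' Khm p o q ⇒ Khm p′ o′ q′)
  MP      : ∀ {φ ψ} → ⊢ φ → ⊢ (φ ⇒ ψ) → ⊢ ψ
  NECU    : ∀ {φ} → ⊢ φ → ⊢ U φ
  SUB     : ∀ {φ} (σ : ℕ → Form) → ⊢ φ → ⊢ subst σ φ

infix 5 ⊢_

FSet : Set₁
FSet = Form → Set

conj : List Form → Form
conj [] = ⊤'
conj (a ∷ as) = a ∧' conj as

Consistent : FSet → Set
Consistent Γ = ∀ (as : List Form) → All Γ as → ¬ (⊢ (conj as ⇒ ⊥'))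

_⊆_ : FSet → FSet → Set
Γ ⊆ Δ = ∀ {φ} → Γ φ → Δ φ

MCS : FSet → Set₁
MCS Γ = Consistent Γ × (∀ (Γ' : FSet) → Γ ⊆ Γ' → Consistent Γ' → Γ' ⊆ Γ)

InΦ : FSet → FSet → Set₁
InΦ Γ Δ = MCS Δ × (∀ a b c → Γ (Khm a b c) ⇔ Δ (Khm a b c))

-- Every Khm-literal of Γ holds in Δ, and by 4KhmU/5KhmU it holds there universally.
-- If these literals together with φ were inconsistent, some finite conjunction of them
-- would prove φ → ⊥, so U(φ → ⊥) ∈ Δ.  UKhm then weakens Khm(ψ, ⊤, φ) to
-- Khm(¬¬ψ, ⊤, ⊥) = U ¬ψ, and TU gives ¬ψ ∈ Δ, contradicting ψ ∈ Δ.  Hence the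
-- literals and φ are consistent, and any maximal consistent extension of them is the
-- required Δ′: it contains φ and, being maximal, agrees with Γ on every Khm-formula.
module Submission where

open import Defs
open import Data.Bool using (Bool; true; false; T)
open import Data.Bool.Properties using (T-≡; T-∧)
open import Data.Empty using (⊥; ⊥-elim)
open import Data.List using (List; []; _∷_; _++_; map; cartesianProductWith; cartesianProduct)
open import Data.List.Membership.Propositional using (_∈_)
open import Data.List.Membership.Propositional.Properties
  using (∈-++⁺ˡ; ∈-++⁺ʳ; ∈-map⁺; ∈-cartesianProductWith⁺; ∈-cartesianProduct⁺)
open import Data.List.Relation.Unary.All using (All; []; _∷_) renaming (map to All-map)
open import Data.List.Relation.Unary.All.Properties using (++⁺; ++⁻)
open import Data.List.Relation.Unary.Any using (here; there)
open import Data.Nat using (ℕ; zero; suc; _≤_; _≤′_; ≤′-refl; ≤′-step; _⊔_)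
open import Data.Nat.Properties using (≤⇒≤′; m≤m⊔n; m≤n⊔m; m≤n⇒m≤n⊔o)
open import Data.Product using (Σ; ∃; _×_; _,_; proj₁; proj₂; uncurry)
open import Data.Product.Function.NonDependent.Propositional using (_×-⇔_)
open import Data.Sum using (inj₁; inj₂; [_,_]′)
open import Function using (id; _∘_)
open import Function.Bundles using (_⇔_; mk⇔; Equivalence)
import Function.Properties.Equivalence as ⇔
open import Relation.Binary.PropositionalEquality using (_≡_; refl; cong; cong₂)
  renaming (subst to ≡-subst)
open import Relation.Nullary using (¬_)
open import Relation.Unary using (_∪_; ｛_｝)

infix 4 _⊨_ _⊩_

_⊨_ : (Form → Bool) → Form → Set
v ⊨ atom n      = T (v (atom n))
v ⊨ ~ A         = ¬ v ⊨ A
v ⊨ A ∧' B      = v ⊨ A × v ⊨ B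
v ⊨ Khm A B C   = T (v (Khm A B C))

⊨⇔T-eval : ∀ v A → v ⊨ A ⇔ T (eval v A)
⊨⇔T-eval v (atom n)    = ⇔.refl
⊨⇔T-eval v (Khm A B C) = ⇔.refl
⊨⇔T-eval v (A ∧' B)    = ⇔.trans (⊨⇔T-eval v A ×-⇔ ⊨⇔T-eval v B) (⇔.sym T-∧)
⊨⇔T-eval v (~ A) with eval v A | ⊨⇔T-eval v A
... | true  | A⇔ = mk⇔ (λ ¬a → ¬a (Equivalence.from A⇔ _)) λ ()
... | false | A⇔ = mk⇔ _ λ _ → Equivalence.to A⇔

Valid : Form → Set
Valid A = ∀ v → v ⊨ A

-- v ⊨ A ⇒ B unfolds to ¬ (v ⊨ A × ¬ v ⊨ B), so validities below are proved by lambdas.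
valid⇒⊢ : ∀ {A} → Valid A → ⊢ A
valid⇒⊢ {A} ⊨A = TAUT λ v → Equivalence.to T-≡ (Equivalence.to (⊨⇔T-eval v A) (⊨A v))

⊢-taut-consequence : ∀ {A B} → ⊢ A → (∀ v → v ⊨ A → v ⊨ B) → ⊢ B
⊢-taut-consequence ⊢A f = MP ⊢A (valid⇒⊢ λ v (a , ¬b) → ¬b (f v a))

⊢-taut-consequence₂ : ∀ {A B C} → ⊢ A → ⊢ B → (∀ v → v ⊨ A → v ⊨ B → v ⊨ C) → ⊢ C
⊢-taut-consequence₂ ⊢A ⊢B f =
  MP ⊢B (MP ⊢A (valid⇒⊢ λ v (a , ¬b⇒c) → ¬b⇒c λ (b , ¬c) → ¬c (f v a b)))

⊢⊤' : ⊢ ⊤'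
⊢⊤' = valid⇒⊢ λ v (x , ¬x) → ¬x x

⊢⇒-refl : ∀ {A} → ⊢ (A ⇒ A)
⊢⇒-refl = valid⇒⊢ λ v (a , ¬a) → ¬a a

⊢¬¬-elim : ∀ {A} → ⊢ (~ ~ A ⇒ A)
⊢¬¬-elim = valid⇒⊢ λ v (¬¬a , ¬a) → ¬¬a ¬a

⊢-explosion : ∀ {a B} → ⊢ (a ∧' ~ a ⇒ B)
⊢-explosion = valid⇒⊢ λ v ((a , ¬a) , _) → ¬a a

⊢⇒-non-contradiction : ∀ {A b} → ⊢ (A ⇒ ~ (b ∧' ~ b))
⊢⇒-non-contradiction = valid⇒⊢ λ v (_ , ¬¬) → ¬¬ λ (b , ¬b) → ¬b b

⊨-conj⁺ : ∀ {v} as → All (v ⊨_) as → v ⊨ conj as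
⊨-conj⁺ []       []       (x , ¬x) = ¬x x
⊨-conj⁺ (a ∷ as) (x ∷ xs) = x , ⊨-conj⁺ as xs

⊨-conj⁻ : ∀ {v} as → v ⊨ conj as → All (v ⊨_) as
⊨-conj⁻ []       _        = []
⊨-conj⁻ (a ∷ as) (x , xs) = x ∷ ⊨-conj⁻ as xs

_⊩_ : FSet → Form → Set
Γ ⊩ χ = ∃ λ as → All Γ as × ⊢ (conj as ⇒ χ)

consistent⇒⊬⊥ : ∀ {Γ} → Consistent Γ → ¬ Γ ⊩ ⊥'
consistent⇒⊬⊥ cΓ (as , as⊆Γ , ⊢⊥) = cΓ as as⊆Γ ⊢⊥

⊬⊥⇒consistent : ∀ {Γ} → ¬ Γ ⊩ ⊥' → Consistent Γ
⊬⊥⇒consistent ⊬⊥ as as⊆Γ ⊢⊥ = ⊬⊥ (as , as⊆Γ , ⊢⊥)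

consistent-⊆ : ∀ {Γ Δ} → Γ ⊆ Δ → Consistent Δ → Consistent Γ
consistent-⊆ Γ⊆Δ cΔ as as⊆Γ = cΔ as (All-map Γ⊆Δ as⊆Γ)

⊩-∈ : ∀ {Γ χ} → Γ χ → Γ ⊩ χ
⊩-∈ {χ = χ} χ∈Γ = χ ∷ [] , χ∈Γ ∷ [] , valid⇒⊢ λ v ((x , _) , ¬x) → ¬x x

⊩-⊢ : ∀ {Γ χ} → ⊢ χ → Γ ⊩ χ
⊩-⊢ ⊢χ = [] , [] , ⊢-taut-consequence ⊢χ λ v x (_ , ¬x) → ¬x x

⊩-mp : ∀ {Γ A B} → Γ ⊩ A → Γ ⊩ A ⇒ B → Γ ⊩ B
⊩-mp (as , as⊆Γ , ⊢A) (bs , bs⊆Γ , ⊢A⇒B) =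
  as ++ bs , ++⁺ as⊆Γ bs⊆Γ , ⊢-taut-consequence₂ ⊢A ⊢A⇒B λ v a a⇒b (c , ¬b) →
    let (ca , cb) = ++⁻ as (⊨-conj⁻ (as ++ bs) c)
    in a⇒b (⊨-conj⁺ bs cb , λ h → a (⊨-conj⁺ as ca , λ x → h (x , ¬b)))

split-∪｛｝ : ∀ {Γ : FSet} {χ} as → All (Γ ∪ ｛ χ ｝) as →
  ∃ λ bs → All Γ bs × (∀ v → v ⊨ conj bs → v ⊨ χ → v ⊨ conj as)
split-∪｛｝ [] [] = [] , [] , λ v _ _ (x , ¬x) → ¬x x
split-∪｛｝ (a ∷ as) (inj₁ a∈Γ ∷ as⊆) =
  let (bs , bs⊆Γ , weaken) = split-∪｛｝ as as⊆
  in a ∷ bs , a∈Γ ∷ bs⊆Γ , λ v (x , b) χ → x , weaken v b χ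
split-∪｛｝ (_ ∷ as) (inj₂ refl ∷ as⊆) =
  let (bs , bs⊆Γ , weaken) = split-∪｛｝ as as⊆
  in bs , bs⊆Γ , λ v b χ → χ , weaken v b χ

⊩-deduction : ∀ {Γ : FSet} {χ θ} → Γ ∪ ｛ χ ｝ ⊩ θ → Γ ⊩ χ ⇒ θ
⊩-deduction (as , as⊆ , ⊢θ) =
  let (bs , bs⊆Γ , weaken) = split-∪｛｝ as as⊆
  in bs , bs⊆Γ , ⊢-taut-consequence ⊢θ λ v h (b , ¬χ⇒θ) →
       ¬χ⇒θ λ (x , ¬θ) → h (weaken v b x , ¬θ)

-- Substituting p := a turns the ⊥' = p ∧ ¬p inside U into a ∧ ¬a, so instances of
-- the axioms speak about U⟨ a ⟩ rather than U.
U⟨_⟩ : Form → Form → Form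
U⟨ a ⟩ χ = Khm (~ χ) (~ (a ∧' ~ a)) (a ∧' ~ a)

shift : ℕ → Form
shift n = atom (suc n)

unshift : Form → ℕ → Form
unshift a zero    = a
unshift a (suc n) = atom n

unshift-shift : ∀ a χ → subst (unshift a) (subst shift χ) ≡ χ
unshift-shift a (atom n)    = refl
unshift-shift a (~ χ)       = cong ~_ (unshift-shift a χ)
unshift-shift a (χ ∧' θ)    = cong₂ _∧'_ (unshift-shift a χ) (unshift-shift a θ)
unshift-shift a (Khm χ θ η) = cong₂ (uncurry Khm) (cong₂ _,_ (unshift-shift a χ) (unshift-shift a θ))
                                (unshift-shift a η)

-- Shifting first moves χ off the letter p, so that p := a only affects U's ⊥'.
NECU⟨⟩ : ∀ {a χ} → ⊢ χ → ⊢ U⟨ a ⟩ χ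
NECU⟨⟩ {a} {χ} ⊢χ =
  ≡-subst (λ θ → ⊢ U⟨ a ⟩ θ) (unshift-shift a χ) (SUB (unshift a) (NECU (SUB shift ⊢χ)))

-- The i-th entry replaces atom i, i.e. the letters p, q, r, o, p′, q′, o′ in this order.
assign : List Form → ℕ → Form
assign []      _       = ⊥'
assign (a ∷ _) zero    = a
assign (_ ∷ as) (suc n) = assign as n

module MCS-Properties {Δ : FSet} (mcs : MCS Δ) where

  private
    Δ-consistent : Consistent Δ
    Δ-consistent = proj₁ mcs

    Δ-maximal : ∀ Γ′ → Δ ⊆ Γ′ → Consistent Γ′ → Γ′ ⊆ Δ
    Δ-maximal = proj₂ mcs

  ∪｛｝-consistent⇒∈ : ∀ {χ} → Consistent (Δ ∪ ｛ χ ｝) → Δ χ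
  ∪｛｝-consistent⇒∈ {χ} c = Δ-maximal (Δ ∪ ｛ χ ｝) inj₁ c (inj₂ refl)

  ⊩⇒∈ : ∀ {χ} → Δ ⊩ χ → Δ χ
  ⊩⇒∈ ⊩χ = ∪｛｝-consistent⇒∈ (⊬⊥⇒consistent λ ⊩⊥ →
    consistent⇒⊬⊥ Δ-consistent (⊩-mp ⊩χ (⊩-deduction ⊩⊥)))

  ∈-⊢ : ∀ {χ} → ⊢ χ → Δ χ
  ∈-⊢ = ⊩⇒∈ ∘ ⊩-⊢

  ∈-mp : ∀ {A B} → Δ A → ⊢ (A ⇒ B) → Δ B
  ∈-mp a ⊢A⇒B = ⊩⇒∈ (⊩-mp (⊩-∈ a) (⊩-⊢ ⊢A⇒B))

  ∈-∧ : ∀ {A B} → Δ A → Δ B → Δ (A ∧' B)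
  ∈-∧ a b = ⊩⇒∈ (⊩-mp (⊩-∈ b) (⊩-mp (⊩-∈ a) (⊩-⊢ (valid⇒⊢ λ v (x , ¬y⇒x∧y) →
    ¬y⇒x∧y λ (y , ¬x∧y) → ¬x∧y (x , y)))))

  ∈-~⇒∉ : ∀ {A} → Δ (~ A) → ¬ Δ A
  ∈-~⇒∉ ¬a a = consistent⇒⊬⊥ Δ-consistent (⊩-mp (⊩-∈ a) (⊩-mp (⊩-∈ ¬a) (⊩-⊢ (valid⇒⊢
    λ v (¬x , ¬x⇒⊥) → ¬x⇒⊥ λ (x , _) → ¬x x))))

  ∉~⇒∪｛｝-consistent : ∀ {χ} → ¬ Δ (~ χ) → Consistent (Δ ∪ ｛ χ ｝)
  ∉~⇒∪｛｝-consistent ∉~χ = ⊬⊥⇒consistent λ ⊩⊥ → ∉~χ (⊩⇒∈ (⊩-mp (⊩-deduction ⊩⊥) (⊩-⊢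
    (valid⇒⊢ λ v (χ⇒⊥ , ¬¬χ) → ¬¬χ λ x → χ⇒⊥ (x , λ (y , ¬y) → ¬y y)))))

  ¬¬∈⇒∈ : ∀ {χ} → ¬ ¬ Δ χ → Δ χ
  ¬¬∈⇒∈ ¬¬χ = ∪｛｝-consistent⇒∈ (∉~⇒∪｛｝-consistent λ ~χ → ¬¬χ (∈-~⇒∉ ~χ))

  ∉⇒∈~ : ∀ {χ} → ¬ Δ χ → Δ (~ χ)
  ∉⇒∈~ ∉χ = ¬¬∈⇒∈ λ ∉~χ → ∉χ (∪｛｝-consistent⇒∈ (∉~⇒∪｛｝-consistent ∉~χ))

  ∈-UKhm⟨⟩ : ∀ {X Y Z X′ Y′ Z′} → Δ (U⟨ X ⟩ (X′ ⇒ X)) → Δ (U⟨ X ⟩ (Y ⇒ Y′)) →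
    Δ (U⟨ X ⟩ (Z ⇒ Z′)) → Δ (Khm X Y Z) → Δ (Khm X′ Y′ Z′)
  ∈-UKhm⟨⟩ {X} {Y} {Z} {X′} {Y′} {Z′} u₁ u₂ u₃ k =
    ∈-mp (∈-∧ (∈-∧ (∈-∧ u₁ u₂) u₃) k) (SUB (assign (X ∷ Z ∷ ⊥' ∷ Y ∷ X′ ∷ Z′ ∷ Y′ ∷ [])) UKhm)

  ∈-Khm-mono : ∀ {X Y Z X′ Y′ Z′} → Δ (Khm X Y Z) →
    ⊢ (X′ ⇒ X) → ⊢ (Y ⇒ Y′) → ⊢ (Z ⇒ Z′) → Δ (Khm X′ Y′ Z′)
  ∈-Khm-mono k ⊢₁ ⊢₂ ⊢₃ = ∈-UKhm⟨⟩ (∈-⊢ (NECU⟨⟩ ⊢₁)) (∈-⊢ (NECU⟨⟩ ⊢₂)) (∈-⊢ (NECU⟨⟩ ⊢₃)) k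

  ∈-U⟨⟩⇒∈-U : ∀ {a χ} → Δ (U⟨ a ⟩ χ) → Δ (U χ)
  ∈-U⟨⟩⇒∈-U u = ∈-Khm-mono u ⊢⇒-refl ⊢⇒-non-contradiction ⊢-explosion

  ∈-U⇒∈-U⟨⟩ : ∀ {a χ} → Δ (U χ) → Δ (U⟨ a ⟩ χ)
  ∈-U⇒∈-U⟨⟩ u = ∈-Khm-mono u ⊢⇒-refl ⊢⇒-non-contradiction ⊢-explosion

  ∈-U-dist : ∀ {A B} → Δ (U A) → Δ (U (A ⇒ B)) → Δ (U B)
  ∈-U-dist {A} {B} u₁ u₂ =
    ∈-U⟨⟩⇒∈-U (∈-mp (∈-∧ (∈-U⇒∈-U⟨⟩ u₁) (∈-U⇒∈-U⟨⟩ u₂)) (SUB (assign (A ∷ B ∷ [])) DISTU))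

  ∈-U⇒∈ : ∀ {A} → Δ (U A) → Δ A
  ∈-U⇒∈ {A} u = ∈-mp (∈-U⇒∈-U⟨⟩ u) (SUB (assign (A ∷ [])) TU)

  ∈-Khm⇒∈-UKhm : ∀ {a b c} → Δ (Khm a b c) → Δ (U (Khm a b c))
  ∈-Khm⇒∈-UKhm {a} {b} {c} k = ∈-U⟨⟩⇒∈-U (∈-mp k (SUB (assign (a ∷ c ∷ ⊥' ∷ b ∷ [])) 4KhmU))

  ∈-¬Khm⇒∈-U¬Khm : ∀ {a b c} → Δ (~ Khm a b c) → Δ (U (~ Khm a b c))
  ∈-¬Khm⇒∈-U¬Khm {a} {b} {c} k = ∈-U⟨⟩⇒∈-U (∈-mp k (SUB (assign (a ∷ c ∷ ⊥' ∷ b ∷ [])) 5KhmU))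

  ∈-UKhm : ∀ {X Y Z X′ Y′ Z′} → Δ (U (X′ ⇒ X)) → Δ (U (Y ⇒ Y′)) → Δ (U (Z ⇒ Z′)) →
    Δ (Khm X Y Z) → Δ (Khm X′ Y′ Z′)
  ∈-UKhm u₁ u₂ u₃ = ∈-UKhm⟨⟩ (∈-U⇒∈-U⟨⟩ u₁) (∈-U⇒∈-U⟨⟩ u₂) (∈-U⇒∈-U⟨⟩ u₃)

  ∈-U-consequence : ∀ {θ} ls → All (Δ ∘ U) ls → ⊢ (conj ls ⇒ θ) → Δ (U θ)
  ∈-U-consequence []       []       ⊢θ = ∈-⊢ (NECU (MP ⊢⊤' ⊢θ))
  ∈-U-consequence (l ∷ ls) (u ∷ us) ⊢θ = ∈-U-dist u (∈-U-consequence ls us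
    (⊢-taut-consequence ⊢θ λ v h (c , ¬¬l∧¬θ) → ¬¬l∧¬θ λ (x , ¬θ) → h ((x , c) , ¬θ)))

  ∈-Khm⊤-U¬goal⇒∈-¬start : ∀ {ψ φ} → Δ (Khm ψ ⊤' φ) → Δ (U (φ ⇒ ⊥')) → Δ (~ ψ)
  ∈-Khm⊤-U¬goal⇒∈-¬start k u = ∈-U⇒∈ (∈-UKhm (∈-⊢ (NECU ⊢¬¬-elim)) (∈-⊢ (NECU ⊢⇒-refl)) u k)

data IsKhmLiteral : Form → Set where
  khm  : ∀ {a b c} → IsKhmLiteral (Khm a b c)
  ¬khm : ∀ {a b c} → IsKhmLiteral (~ Khm a b c)

KhmLiterals : FSet → FSet
KhmLiterals Γ χ = IsKhmLiteral χ × Γ χ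

KhmLiterals-necessary : ∀ {Γ Δ} → MCS Γ → InΦ Γ Δ → KhmLiterals Γ ⊆ (Δ ∘ U)
KhmLiterals-necessary mcsΓ (mcsΔ , sameKhm) = λ
  { (khm {a} {b} {c} , k)   → ∈-Khm⇒∈-UKhm (Equivalence.to (sameKhm a b c) k)
  ; (¬khm {a} {b} {c} , ¬k) → ∈-¬Khm⇒∈-U¬Khm (∉⇒∈~ λ k → Γ.∈-~⇒∉ ¬k (Equivalence.from (sameKhm a b c) k))
  }
  where
  open MCS-Properties mcsΔ
  module Γ = MCS-Properties mcsΓ

seed-consistent : ∀ {Γ Δ ψ φ} → MCS Γ → InΦ Γ Δ → Γ (Khm ψ ⊤' φ) → Δ ψ →
  Consistent (KhmLiterals Γ ∪ ｛ φ ｝)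
seed-consistent {ψ = ψ} {φ} mcsΓ Δ∈Φ@(mcsΔ , sameKhm) kΓ ψ∈Δ = ⊬⊥⇒consistent λ ⊩⊥ →
  let (ls , ls⊆ , ⊢ls⇒¬φ) = ⊩-deduction ⊩⊥
      U¬φ = ∈-U-consequence ls (All-map (KhmLiterals-necessary mcsΓ Δ∈Φ) ls⊆) ⊢ls⇒¬φ
  in ∈-~⇒∉ (∈-Khm⊤-U¬goal⇒∈-¬start (Equivalence.to (sameKhm ψ ⊤' φ) kΓ) U¬φ) ψ∈Δ
  where open MCS-Properties mcsΔ

Khm-agreement : ∀ {Γ Δ} → MCS Γ → MCS Δ → KhmLiterals Γ ⊆ Δ →
  ∀ a b c → Γ (Khm a b c) ⇔ Δ (Khm a b c)
Khm-agreement mcsΓ mcsΔ lits⊆Δ a b c = mk⇔ (λ k → lits⊆Δ (khm , k))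
  λ k → Γ.¬¬∈⇒∈ λ ∉Γ → Δ.∈-~⇒∉ (lits⊆Δ (¬khm , Γ.∉⇒∈~ ∉Γ)) k
  where
  module Γ = MCS-Properties mcsΓ
  module Δ = MCS-Properties mcsΔ

-- χ is added exactly when this keeps the set consistent; that condition is never decided.
extendWith : FSet → Form → FSet
extendWith S χ = S ∪ λ x → χ ≡ x × Consistent (S ∪ ｛ χ ｝)

-- Consistency is a negation, so we may assume χ was either added or not.
extendWith-consistent : ∀ {S χ} → Consistent S → Consistent (extendWith S χ)
extendWith-consistent {S} {χ} cS as as⊆ ⊢⊥ =
  not-added λ c → c as (All-map [ inj₁ , inj₂ ∘ proj₁ ]′ as⊆) ⊢⊥
  where
  not-added : ¬ Consistent (S ∪ ｛ χ ｝) → ⊥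
  not-added ¬c = cS as (All-map [ id , ⊥-elim ∘ ¬c ∘ proj₂ ]′ as⊆) ⊢⊥

extendWithAll : FSet → List Form → FSet
extendWithAll S []       = S
extendWithAll S (χ ∷ χs) = extendWith (extendWithAll S χs) χ

extendWithAll-consistent : ∀ {S} χs → Consistent S → Consistent (extendWithAll S χs)
extendWithAll-consistent []       cS = cS
extendWithAll-consistent (_ ∷ χs) cS = extendWith-consistent (extendWithAll-consistent χs cS)

⊆-extendWithAll : ∀ {S} χs → S ⊆ extendWithAll S χs
⊆-extendWithAll []       s = s
⊆-extendWithAll (_ ∷ χs) s = inj₁ (⊆-extendWithAll χs s)

extendWithAll-saturated : ∀ {S Γ χ χs} → χ ∈ χs → extendWithAll S χs ⊆ Γ → Consistent Γ →
  Γ χ → extendWithAll S χs χ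
extendWithAll-saturated (here refl) ext⊆Γ cΓ χ∈Γ =
  inj₂ (refl , consistent-⊆ [ ext⊆Γ ∘ inj₁ , (λ { refl → χ∈Γ }) ]′ cΓ)
extendWithAll-saturated (there χ∈χs) ext⊆Γ cΓ χ∈Γ =
  inj₁ (extendWithAll-saturated χ∈χs (ext⊆Γ ∘ inj₁) cΓ χ∈Γ)

grow : ℕ → List Form → List Form
grow n L = atom n ∷ map ~_ L ++ cartesianProductWith _∧'_ L L
  ++ cartesianProductWith (uncurry ∘ Khm) L (cartesianProduct L L)

formulas : ℕ → List Form
formulas zero    = []
formulas (suc n) = grow n (formulas n) ++ formulas n

formulas-mono : ∀ {m n χ} → m ≤ n → χ ∈ formulas m → χ ∈ formulas n
formulas-mono = go ∘ ≤⇒≤′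
  where
  go : ∀ {m n χ} → m ≤′ n → χ ∈ formulas m → χ ∈ formulas n
  go ≤′-refl         χ∈ = χ∈
  go (≤′-step {n} m≤n) χ∈ = ∈-++⁺ʳ (grow n (formulas n)) (go m≤n χ∈)

grow⊆formulas : ∀ {n χ} → χ ∈ grow n (formulas n) → χ ∈ formulas (suc n)
grow⊆formulas {n} = ∈-++⁺ˡ {xs = grow n (formulas n)}

formulas-complete : ∀ χ → ∃ λ n → χ ∈ formulas n
formulas-complete (atom n) = suc n , grow⊆formulas (here refl)
formulas-complete (~ A) =
  let (n , A∈) = formulas-complete A
  in suc n , grow⊆formulas (there (∈-++⁺ˡ (∈-map⁺ ~_ A∈)))
formulas-complete (A ∧' B) =
  let (n₁ , A∈) = formulas-complete A
      (n₂ , B∈) = formulas-complete B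
      n = n₁ ⊔ n₂
      L = formulas n
  in suc n , grow⊆formulas (there (∈-++⁺ʳ (map ~_ L) (∈-++⁺ˡ (∈-cartesianProductWith⁺ _∧'_
       (formulas-mono (m≤m⊔n n₁ n₂) A∈) (formulas-mono (m≤n⊔m n₁ n₂) B∈)))))
formulas-complete (Khm A B C) =
  let (n₁ , A∈) = formulas-complete A
      (n₂ , B∈) = formulas-complete B
      (n₃ , C∈) = formulas-complete C
      n = n₁ ⊔ n₂ ⊔ n₃
      L = formulas n
  in suc n , grow⊆formulas (there (∈-++⁺ʳ (map ~_ L) (∈-++⁺ʳ (cartesianProductWith _∧'_ L L)
       (∈-cartesianProductWith⁺ (uncurry ∘ Khm)
         (formulas-mono (m≤n⇒m≤n⊔o n₃ (m≤m⊔n n₁ n₂)) A∈)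
         (∈-cartesianProduct⁺ (formulas-mono (m≤n⇒m≤n⊔o n₃ (m≤n⊔m n₁ n₂)) B∈)
                              (formulas-mono (m≤n⊔m (n₁ ⊔ n₂) n₃) C∈))))))

⋃ : (ℕ → FSet) → FSet
⋃ F χ = ∃ λ n → F n χ

⋃-consistent : ∀ (F : ℕ → FSet) → (∀ n → F n ⊆ F (suc n)) → (∀ n → Consistent (F n)) →
  Consistent (⋃ F)
⋃-consistent F step cF as as⊆ = let (n , as⊆Fn) = bound as as⊆ in cF n as as⊆Fn
  where
  mono : ∀ {m n} → m ≤′ n → F m ⊆ F n
  mono ≤′-refl         x = x
  mono (≤′-step m≤n) x = step _ (mono m≤n x)

  bound : ∀ as → All (⋃ F) as → ∃ λ n → All (F n) as
  bound []       []               = zero , []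
  bound (_ ∷ as) ((m , a) ∷ as⊆) =
    let (n , as⊆Fn) = bound as as⊆
    in m ⊔ n , mono (≤⇒≤′ (m≤m⊔n m n)) a ∷ All-map (mono (≤⇒≤′ (m≤n⊔m m n))) as⊆Fn

stage : FSet → ℕ → FSet
stage S zero    = S
stage S (suc n) = extendWithAll (stage S n) (formulas n)

lindenbaum : ∀ {S} → Consistent S → Σ FSet λ Δ → MCS Δ × S ⊆ Δ
lindenbaum {S} cS = ⋃ (stage S) , (consistent , maximal) , λ s → zero , s
  where
  consistent : Consistent (⋃ (stage S))
  consistent = ⋃-consistent (stage S) (λ n → ⊆-extendWithAll (formulas n)) stage-consistent
    where
    stage-consistent : ∀ n → Consistent (stage S n)
    stage-consistent zero    = cS
    stage-consistent (suc n) = extendWithAll-consistent (formulas n) (stage-consistent n)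

  maximal : ∀ Γ → ⋃ (stage S) ⊆ Γ → Consistent Γ → Γ ⊆ ⋃ (stage S)
  maximal Γ ⋃⊆Γ cΓ {χ} χ∈Γ =
    let (n , χ∈formulas) = formulas-complete χ
    in suc n , extendWithAll-saturated χ∈formulas (λ x → ⋃⊆Γ (suc n , x)) cΓ χ∈Γ

proposition8 : (Γ : FSet) → MCS Γ → (ψ φ : Form) → Γ (Khm ψ ⊤' φ) →
    (Δ : FSet) → InΦ Γ Δ → Δ ψ →
    Σ FSet (λ Δ' → InΦ Γ Δ' × Δ' φ)
proposition8 Γ mcsΓ ψ φ kΓ Δ Δ∈Φ ψ∈Δ =
  let (Δ′ , mcsΔ′ , seed⊆Δ′) = lindenbaum (seed-consistent mcsΓ Δ∈Φ kΓ ψ∈Δ)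
  in Δ′ , (mcsΔ′ , Khm-agreement mcsΓ mcsΔ′ (seed⊆Δ′ ∘ inj₁)) , seed⊆Δ′ (inj₂ refl)
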